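{- If $G$ is a graph on $n$ vertices having at least $\log_2(n)-1$ universal vertices, then $D(G,x)$ is unimodal with a mode at $\lceil n/2\rceil$ or $\lceil n/2\rceil+1$.
   Context: $G$ is a finite simple graph. A vertex is universal if it is adjacent to every other vertex. A set $U\subseteq V(G)$ is dominating if every vertex is in $U$ or adjacent to a vertex of $U$; $d_i(G)$ is the number of dominating sets of size $i$ and $D(G,x)=\sum_{i=1}^n d_i(G)x^i$. A polynomial is unimodal if its coefficients (ordered by increasing power of $x$) are non-decreasing and then non-increasing; it has a mode at $k$ if the coefficient of $x^k$ is the maximum coefficient. -}

module Defs where

open import Data.Bool using (Bool; true; false; _∧_; _∨_; not; if_then_else_)
open import Data.Nat using (ℕ; zero; suc; _+_; _≤_; _<_; _≡ᵇ_)
open import Data.Fin using (Fin; _≟_)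
open import Data.Fin.Subset using (Subset; _∈_; ∣_∣)
open import Data.Vec using (Vec; []; _∷_; lookup)
open import Data.List using (List; []; _∷_; map; _++_; length; allFin)
open import Data.Bool.ListAction using (all; any)
open import Data.Product using (∃-syntax; _×_)
open import Relation.Binary.PropositionalEquality using (_≡_)
open import Relation.Nullary using (¬_; does)

record Graph (n : ℕ) : Set where
  field
    adj   : Fin n → Fin n → Bool
    sym   : ∀ u v → adj u v ≡ adj v u
    irrefl : ∀ v → adj v v ≡ false
open Graph public

Universal : ∀ {n} → Graph n → Fin n → Set
Universal G v = ∀ w → ¬ (w ≡ v) → adj G v w ≡ true

isDominating : ∀ {n} → Graph n → Subset n → Bool
isDominating {n} G U =
  all (λ v → lookup U v ∨ any (λ u → lookup U u ∧ adj G u v) (allFin n)) (allFin n)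

allSubsets : (n : ℕ) → List (Subset n)
allSubsets zero    = [] ∷ []
allSubsets (suc n) = map (false ∷_) (allSubsets n) ++ map (true ∷_) (allSubsets n)

countB : ∀ {A : Set} → (A → Bool) → List A → ℕ
countB p []       = 0
countB p (x ∷ xs) = if p x then suc (countB p xs) else countB p xs

-- D(G,x) = Σ_{i=1}^n d_i(G) x^i, so d i is the coefficient of x^i (d 0 G = 0 automatically,
-- since the empty set dominates no graph with n ≥ 1 vertices).
d : ∀ {n} → Graph n → ℕ → ℕ
d {n} G i = countB (λ U → isDominating G U ∧ (∣ U ∣ ≡ᵇ i)) (allSubsets n)

Unimodal : ℕ → (ℕ → ℕ) → Set
Unimodal n a = ∃[ k ] (k ≤ n
  × (∀ i j → i ≤ j → j ≤ k → a i ≤ a j)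
  × (∀ i j → k ≤ i → i ≤ j → j ≤ n → a j ≤ a i))

ModeAt : (ℕ → ℕ) → ℕ → Set
ModeAt a k = ∀ i → a i ≤ a k

-- The dominating sets form an up-set, and for an up-set the local LYM inequality
-- (n - i) d_i ≤ (i + 1) d_(i+1) makes the coefficients grow up to ⌈n/2⌉. Every set meeting the
-- set S of k universal vertices dominates, so C(n,i) - C(n-k,i) ≤ d_i ≤ C(n,i). Beyond ⌈n/2⌉ + 1
-- the drop C(n,i) - C(n,i+1) is a fraction (2i+1-n)/(i+1) of C(n,i) ≥ 2^k C(n-k,i), which is at
-- least C(n-k,i) once n ≤ 2^(k+1); hence d_(i+1) ≤ C(n,i+1) ≤ C(n,i) - C(n-k,i) ≤ d_i.
module Submission where

open import Defs hiding (sym)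
open import Data.Bool using (Bool; true; false; T; _∧_; _∨_)
open import Data.Bool.ListAction using (any)
open import Data.Bool.Properties using (∧-zeroʳ; T-∧; T-∨; T-≡)
open import Data.Empty using (⊥-elim)
open import Data.Fin using (Fin) renaming (_≟_ to _≟ᶠ_)
open import Data.Fin.Subset using (Subset; _∈_; _⊆_; ∣_∣; ∁; ⊤; inside; outside)
open import Data.Fin.Subset.Properties
  using (_⊆?_; _∈?_; ⊆⊤; ⊆-refl; out⊆; in⊆in; x∉p⇒x∈∁p; ∣⊤∣≡n; ∣∁p∣≡n∸∣p∣; ∣p∣≤n)
open import Data.List using ([]; _∷_; map; _++_; allFin)
open import Data.List.Membership.Propositional.Properties using (∈-allFin)
import Data.List.Relation.Unary.All as All
import Data.List.Relation.Unary.Any as Any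
open import Data.List.Relation.Unary.All.Properties using (all⁺; all⁻)
open import Data.List.Relation.Unary.Any.Properties using (any⁺; any⁻)
open import Data.Nat
open import Data.Nat.Properties
open import Data.Nat.Combinatorics using (_C_; nC1≡n; nCk+nC[k+1]≡[n+1]C[k+1]; k>n⇒nCk≡0)
open import Data.Nat.Tactic.RingSolver using (solve-∀)
open import Data.Product using (_×_; _,_; map₁; map₂)
open import Data.Sum using (_⊎_; inj₁; inj₂)
import Data.Sum as Sum
open import Data.Vec using (_∷_; []; lookup)
open import Data.Vec.Properties using ([]=⇒lookup; lookup⇒[]=)
open import Function using (_∘_)
open import Function.Bundles using (Equivalence)
open import Relation.Nullary using (¬_; yes; no; does)
open import Relation.Nullary.Decidable using (T?; dec-true)
open import Relation.Binary.PropositionalEquality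

open Equivalence using (to; from)

[k+1]*[n+1]C[k+1]≡[n+1]*nCk : ∀ n k → suc k * (suc n C suc k) ≡ suc n * (n C k)
[k+1]*[n+1]C[k+1]≡[n+1]*nCk zero    zero    = refl
[k+1]*[n+1]C[k+1]≡[n+1]*nCk zero    (suc k) = *-zeroʳ (suc (suc k))
[k+1]*[n+1]C[k+1]≡[n+1]*nCk (suc n) zero    =
  trans (*-identityˡ _) (trans (nC1≡n (suc (suc n))) (sym (*-identityʳ _)))
[k+1]*[n+1]C[k+1]≡[n+1]*nCk (suc n) (suc k) = begin
  suc (suc k) * (suc (suc n) C suc (suc k))
    ≡⟨ cong (suc (suc k) *_) (nCk+nC[k+1]≡[n+1]C[k+1] (suc n) (suc k)) ⟨
  suc (suc k) * (suc n C suc k + suc n C suc (suc k))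
    ≡⟨ *-distribˡ-+ (suc (suc k)) (suc n C suc k) _ ⟩
  (suc n C suc k + suc k * (suc n C suc k)) + suc (suc k) * (suc n C suc (suc k))
    ≡⟨ cong₂ (λ a b → (suc n C suc k + a) + b)
         ([k+1]*[n+1]C[k+1]≡[n+1]*nCk n k) ([k+1]*[n+1]C[k+1]≡[n+1]*nCk n (suc k)) ⟩
  (suc n C suc k + suc n * (n C k)) + suc n * (n C suc k)
    ≡⟨ +-assoc (suc n C suc k) _ _ ⟩
  suc n C suc k + (suc n * (n C k) + suc n * (n C suc k))
    ≡⟨ cong (suc n C suc k +_) (*-distribˡ-+ (suc n) (n C k) _) ⟨
  suc n C suc k + suc n * (n C k + n C suc k)
    ≡⟨ cong (λ t → suc n C suc k + suc n * t) (nCk+nC[k+1]≡[n+1]C[k+1] n k) ⟩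
  suc (suc n) * (suc n C suc k) ∎
  where open ≡-Reasoning

-- By Pascal's rule and absorption, (k+1) (C(n,k) - C(n,k+1)) = (2k+1-n) C(n,k).
nC[k+1]+x≤nCk : ∀ {n k} x → n ≤ suc (2 * k) → suc k * x ≤ (suc (2 * k) ∸ n) * (n C k)
              → n C suc k + x ≤ n C k
nC[k+1]+x≤nCk {n} {k} x n≤2k+1 x-bound =
  *-cancelˡ-≤ (suc k) (+-cancelʳ-≤ (suc k * (n C k)) _ _ (begin
    suc k * (n C suc k + x) + suc k * (n C k)
      ≡⟨ shuffle (suc k) (n C suc k) x (n C k) ⟩
    suc k * (n C k + n C suc k) + suc k * x
      ≡⟨ cong (λ t → suc k * t + suc k * x) (nCk+nC[k+1]≡[n+1]C[k+1] n k) ⟩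
    suc k * (suc n C suc k) + suc k * x
      ≡⟨ cong (_+ suc k * x) ([k+1]*[n+1]C[k+1]≡[n+1]*nCk n k) ⟩
    suc n * (n C k) + suc k * x
      ≤⟨ +-monoʳ-≤ (suc n * (n C k)) x-bound ⟩
    suc n * (n C k) + c * (n C k)
      ≡⟨ *-distribʳ-+ (n C k) (suc n) c ⟨
    (suc n + c) * (n C k)
      ≡⟨ cong (λ t → suc t * (n C k)) (m+[n∸m]≡n n≤2k+1) ⟩
    suc (suc (2 * k)) * (n C k)
      ≡⟨ double k (n C k) ⟩
    suc k * (n C k) + suc k * (n C k) ∎))
  where
    open ≤-Reasoning
    c = suc (2 * k) ∸ n
    shuffle : ∀ a b x y → a * (b + x) + a * y ≡ a * (y + b) + a * x
    shuffle = solve-∀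
    double : ∀ k y → suc (suc (2 * k)) * y ≡ suc k * y + suc k * y
    double = solve-∀

nC[k+1]≤nCk : ∀ {n k} → n ≤ suc (2 * k) → n C suc k ≤ n C k
nC[k+1]≤nCk {n} {k} n≤2k+1 = ≤-trans (≤-reflexive (sym (+-identityʳ (n C suc k))))
  (nC[k+1]+x≤nCk 0 n≤2k+1 (≤-trans (≤-reflexive (*-zeroʳ (suc k))) z≤n))

2*nCk≤[n+1]Ck : ∀ n k → suc n ≤ 2 * k → 2 * (n C k) ≤ suc n C k
2*nCk≤[n+1]Ck n (suc k) n<2+2k = begin
  2 * (n C suc k)          ≡⟨ cong (n C suc k +_) (+-identityʳ (n C suc k)) ⟩
  n C suc k + n C suc k    ≤⟨ +-monoˡ-≤ (n C suc k) (nC[k+1]≤nCk n≤2k+1) ⟩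
  n C k + n C suc k        ≡⟨ nCk+nC[k+1]≡[n+1]C[k+1] n k ⟩
  suc n C suc k            ∎
  where
    open ≤-Reasoning
    n≤2k+1 : n ≤ suc (2 * k)
    n≤2k+1 = ≤-pred (≤-trans n<2+2k (≤-reflexive (*-suc 2 k)))

2^j*nCk≤[n+j]Ck : ∀ n k j → n + j ≤ 2 * k → 2 ^ j * (n C k) ≤ (n + j) C k
2^j*nCk≤[n+j]Ck n k zero    _ rewrite +-identityʳ n = ≤-reflexive (*-identityˡ (n C k))
2^j*nCk≤[n+j]Ck n k (suc j) n+1+j≤2k = begin
  2 ^ suc j * (n C k)      ≡⟨ *-assoc 2 (2 ^ j) (n C k) ⟩
  2 * (2 ^ j * (n C k))    ≤⟨ *-monoʳ-≤ 2 (2^j*nCk≤[n+j]Ck n k j n+j≤2k) ⟩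
  2 * ((n + j) C k)        ≤⟨ 2*nCk≤[n+1]Ck (n + j) k (≤-trans (≤-reflexive (sym (+-suc n j))) n+1+j≤2k) ⟩
  suc (n + j) C k          ≡⟨ cong (_C k) (+-suc n j) ⟨
  (n + suc j) C k          ∎
  where
    open ≤-Reasoning
    n+j≤2k : n + j ≤ 2 * k
    n+j≤2k = ≤-trans (+-monoʳ-≤ n (n≤1+n j)) n+1+j≤2k

1+k≤[2k+1-n]*q : ∀ {n} k {q} → 1 ≤ q → n ≤ 2 * q → n + 2 ≤ 2 * k → suc k ≤ (suc (2 * k) ∸ n) * q
1+k≤[2k+1-n]*q {n} k {q} 1≤q n≤2q n+2≤2k = *-cancelˡ-≤ 2 (begin
  2 * suc k            ≡⟨ trans (*-suc 2 k) (cong suc (sym (m+[n∸m]≡n n≤2k+1))) ⟩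
  suc n + c            ≤⟨ +-mono-≤ (s≤s n≤2q) (m≤m*q c) ⟩
  suc (2 * q) + c * q  ≤⟨ +-monoˡ-≤ (c * q) (≤-trans (+-monoˡ-≤ (2 * q) 1≤q) (≤-reflexive (thrice q))) ⟩
  3 * q + c * q        ≤⟨ +-monoˡ-≤ (c * q) (*-monoˡ-≤ q 3≤c) ⟩
  c * q + c * q        ≡⟨ cong (c * q +_) (+-identityʳ (c * q)) ⟨
  2 * (c * q)          ∎)
  where
    open ≤-Reasoning
    c = suc (2 * k) ∸ n
    n≤2k+1 : n ≤ suc (2 * k)
    n≤2k+1 = ≤-trans (m≤m+n n 2) (≤-trans n+2≤2k (n≤1+n (2 * k)))
    3≤c : 3 ≤ c
    3≤c = m+n≤o⇒m≤o∸n 3 (s≤s (≤-trans (≤-reflexive (+-comm 2 n)) n+2≤2k))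
    m≤m*q : ∀ m → m ≤ m * q
    m≤m*q m = ≤-trans (≤-reflexive (sym (*-identityʳ m))) (*-monoʳ-≤ m 1≤q)
    thrice : ∀ q → q + 2 * q ≡ 3 * q
    thrice = solve-∀

nC[k+1]+mCk≤nCk : ∀ m j {n} k → m + j ≡ n → n ≤ 2 ^ (j + 1) → n + 2 ≤ 2 * k
                → n C suc k + m C k ≤ n C k
nC[k+1]+mCk≤nCk m j k refl n≤2^[j+1] n+2≤2k = nC[k+1]+x≤nCk (m C k) n≤2k+1 (begin
  suc k * (m C k)          ≤⟨ *-monoˡ-≤ (m C k) (1+k≤[2k+1-n]*q k (m^n>0 2 j) n≤2*2^j n+2≤2k) ⟩
  c * 2 ^ j * (m C k)      ≡⟨ *-assoc c (2 ^ j) (m C k) ⟩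
  c * (2 ^ j * (m C k))    ≤⟨ *-monoʳ-≤ c (2^j*nCk≤[n+j]Ck m k j n≤2k) ⟩
  c * ((m + j) C k)        ∎)
  where
    open ≤-Reasoning
    c = suc (2 * k) ∸ (m + j)
    n≤2k : m + j ≤ 2 * k
    n≤2k = ≤-trans (m≤m+n (m + j) 2) n+2≤2k
    n≤2k+1 : m + j ≤ suc (2 * k)
    n≤2k+1 = ≤-trans n≤2k (n≤1+n (2 * k))
    n≤2*2^j : m + j ≤ 2 * 2 ^ j
    n≤2*2^j = ≤-trans n≤2^[j+1] (≤-reflexive (cong (2 ^_) (+-comm j 1)))

module _ {A : Set} where

  countB-++ : ∀ (p : A → Bool) xs ys → countB p (xs ++ ys) ≡ countB p xs + countB p ys
  countB-++ p []       ys = refl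
  countB-++ p (x ∷ xs) ys with p x
  ... | true  = cong suc (countB-++ p xs ys)
  ... | false = countB-++ p xs ys

  countB-none : ∀ {p : A → Bool} → (∀ x → p x ≡ false) → ∀ xs → countB p xs ≡ 0
  countB-none p≡false []       = refl
  countB-none p≡false (x ∷ xs) rewrite p≡false x = countB-none p≡false xs

  countB-≤-∷ : ∀ (p : A → Bool) x xs → countB p xs ≤ countB p (x ∷ xs)
  countB-≤-∷ p x xs with p x
  ... | true  = n≤1+n (countB p xs)
  ... | false = ≤-refl

  countB-mono : ∀ {p q : A → Bool} → (∀ x → T (p x) → T (q x)) → ∀ xs → countB p xs ≤ countB q xs
  countB-mono p⇒q [] = z≤n
  countB-mono {p} {q} p⇒q (x ∷ xs) with p x | p⇒q x
  ... | false | _    = ≤-trans (countB-mono p⇒q xs) (countB-≤-∷ q x xs)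
  ... | true  | px⇒qx with q x | px⇒qx _
  ...   | true | _ = s≤s (countB-mono p⇒q xs)

  countB-cover : ∀ {p q r : A → Bool} → (∀ x → T (p x) → T (q x) ⊎ T (r x)) → ∀ xs
               → countB p xs ≤ countB q xs + countB r xs
  countB-cover p⇒q∨r [] = z≤n
  countB-cover {p} {q} {r} p⇒q∨r (x ∷ xs) with p x | p⇒q∨r x
  ... | false | _ =
    ≤-trans (countB-cover p⇒q∨r xs) (+-mono-≤ (countB-≤-∷ q x xs) (countB-≤-∷ r x xs))
  ... | true  | px⇒qx∨rx with q x | px⇒qx∨rx _
  ...   | true  | _ =
    s≤s (≤-trans (countB-cover p⇒q∨r xs) (+-monoʳ-≤ (countB q xs) (countB-≤-∷ r x xs)))
  ...   | false | inj₂ rx with r x | rx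
  ...     | true | _ = ≤-trans (s≤s (countB-cover p⇒q∨r xs)) (≤-reflexive (sym (+-suc _ _)))

countB-map : ∀ {A B : Set} (p : B → Bool) (f : A → B) xs → countB p (map f xs) ≡ countB (p ∘ f) xs
countB-map p f [] = refl
countB-map p f (x ∷ xs) with p (f x)
... | true  = cong suc (countB-map p f xs)
... | false = countB-map p f xs

countB-allSubsets : ∀ {n} (p : Subset (suc n) → Bool)
                  → countB p (allSubsets (suc n))
                  ≡ countB (p ∘ (outside ∷_)) (allSubsets n) + countB (p ∘ (inside ∷_)) (allSubsets n)
countB-allSubsets {n} p = trans (countB-++ p (map (outside ∷_) (allSubsets n)) _)
  (cong₂ _+_ (countB-map p (outside ∷_) (allSubsets n)) (countB-map p (inside ∷_) (allSubsets n)))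

-- A family of subsets of Fin n is a Boolean predicate; level P i counts its members of size i,
-- so that d G = level (isDominating G) by definition.
level : ∀ {n} → (Subset n → Bool) → ℕ → ℕ
level {n} P i = countB (λ U → P U ∧ (∣ U ∣ ≡ᵇ i)) (allSubsets n)

level-zero : ∀ {n} (P : Subset (suc n) → Bool) → level P 0 ≡ level (P ∘ (outside ∷_)) 0
level-zero {n} P = trans (countB-allSubsets (λ U → P U ∧ (∣ U ∣ ≡ᵇ 0)))
  (trans (cong (level (P ∘ (outside ∷_)) 0 +_)
               (countB-none (λ U → ∧-zeroʳ (P (inside ∷ U))) (allSubsets n)))
         (+-identityʳ _))

level-suc : ∀ {n} (P : Subset (suc n) → Bool) i
          → level P (suc i) ≡ level (P ∘ (outside ∷_)) (suc i) + level (P ∘ (inside ∷_)) i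
level-suc P i = countB-allSubsets (λ U → P U ∧ (∣ U ∣ ≡ᵇ suc i))

level-mono : ∀ {n} {P Q : Subset n → Bool} → (∀ U → T (P U) → T (Q U))
           → ∀ i → level P i ≤ level Q i
level-mono {n} P⇒Q i = countB-mono (λ U → from T-∧ ∘ map₁ (P⇒Q U) ∘ to T-∧) (allSubsets n)

level-cover : ∀ {n} {P Q R : Subset n → Bool} → (∀ U → T (R U) → T (P U) ⊎ T (Q U))
            → ∀ i → level R i ≤ level P i + level Q i
level-cover {n} {P} {Q} {R} R⇒P∨Q i = countB-cover cover (allSubsets n)
  where
    cover : ∀ U → T (R U ∧ (∣ U ∣ ≡ᵇ i)) → T (P U ∧ (∣ U ∣ ≡ᵇ i)) ⊎ T (Q U ∧ (∣ U ∣ ≡ᵇ i))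
    cover U RU∧sized with to T-∧ RU∧sized
    ... | RU , sized = Sum.map (λ PU → from T-∧ (PU , sized)) (λ QU → from T-∧ (QU , sized)) (R⇒P∨Q U RU)

_⊆ᵇ_ : ∀ {n} → Subset n → Subset n → Bool
p ⊆ᵇ q = does (p ⊆? q)

⊆⇒T-⊆ᵇ : ∀ {n} (p q : Subset n) → p ⊆ q → T (p ⊆ᵇ q)
⊆⇒T-⊆ᵇ p q p⊆q = from T-≡ (dec-true (p ⊆? q) p⊆q)

level-⊆ : ∀ {n} (q : Subset n) i → level (_⊆ᵇ q) i ≡ ∣ q ∣ C i
level-⊆ []            zero    = refl
level-⊆ []            (suc i) = refl
level-⊆ (outside ∷ q) zero    = trans (level-zero (_⊆ᵇ (outside ∷ q))) (level-⊆ q zero)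
level-⊆ (inside  ∷ q) zero    = trans (level-zero (_⊆ᵇ (inside ∷ q))) (level-⊆ q zero)
level-⊆ {suc n} (outside ∷ q) (suc i) = begin
  level (_⊆ᵇ (outside ∷ q)) (suc i)                     ≡⟨ level-suc (_⊆ᵇ (outside ∷ q)) i ⟩
  level (_⊆ᵇ q) (suc i) + level {n} (λ _ → false) i     ≡⟨ cong (level (_⊆ᵇ q) (suc i) +_) nothing ⟩
  level (_⊆ᵇ q) (suc i) + 0                             ≡⟨ +-identityʳ _ ⟩
  level (_⊆ᵇ q) (suc i)                                 ≡⟨ level-⊆ q (suc i) ⟩
  ∣ q ∣ C suc i                                         ∎
  where
    open ≡-Reasoning
    nothing : level {n} (λ _ → false) i ≡ 0
    nothing = countB-none (λ _ → refl) (allSubsets n)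
level-⊆ (inside  ∷ q) (suc i) = begin
  level (_⊆ᵇ (inside ∷ q)) (suc i)          ≡⟨ level-suc (_⊆ᵇ (inside ∷ q)) i ⟩
  level (_⊆ᵇ q) (suc i) + level (_⊆ᵇ q) i   ≡⟨ cong₂ _+_ (level-⊆ q (suc i)) (level-⊆ q i) ⟩
  ∣ q ∣ C suc i + ∣ q ∣ C i                 ≡⟨ +-comm (∣ q ∣ C suc i) _ ⟩
  ∣ q ∣ C i + ∣ q ∣ C suc i                 ≡⟨ nCk+nC[k+1]≡[n+1]C[k+1] ∣ q ∣ i ⟩
  suc ∣ q ∣ C suc i                         ∎
  where open ≡-Reasoning

level≤nCi : ∀ {n} (P : Subset n → Bool) i → level P i ≤ n C i
level≤nCi {n} P i = begin
  level P i             ≤⟨ level-mono {n} (λ U _ → ⊆⇒T-⊆ᵇ U ⊤ ⊆⊤) i ⟩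
  level {n} (_⊆ᵇ ⊤) i   ≡⟨ level-⊆ (⊤ {n}) i ⟩
  ∣ ⊤ {n} ∣ C i         ≡⟨ cong (_C i) (∣⊤∣≡n n) ⟩
  n C i                 ∎
  where open ≤-Reasoning

level-vanish : ∀ {n} (P : Subset n → Bool) {i} → n < i → level P i ≡ 0
level-vanish P {i} n<i = n≤0⇒n≡0 (≤-trans (level≤nCi P i) (≤-reflexive (k>n⇒nCk≡0 n<i)))

IsUpSet : ∀ {n} → (Subset n → Bool) → Set
IsUpSet P = ∀ {U V} → U ⊆ V → T (P U) → T (P V)

upSet-outside : ∀ {n} {P : Subset (suc n) → Bool} → IsUpSet P → IsUpSet (P ∘ (outside ∷_))
upSet-outside up = up ∘ out⊆

upSet-inside : ∀ {n} {P : Subset (suc n) → Bool} → IsUpSet P → IsUpSet (P ∘ (inside ∷_))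
upSet-inside up = up ∘ in⊆in

upSet-outside⇒inside : ∀ {n} {P : Subset (suc n) → Bool} → IsUpSet P
                     → ∀ U → T (P (outside ∷ U)) → T (P (inside ∷ U))
upSet-outside⇒inside up U = up (out⊆ ⊆-refl)

[a+1]*[x+y]≤[b+1]*[x′+y′] : ∀ a b x y x′ y′ → a * x ≤ suc b * x′ → suc a * y ≤ b * y′ → x ≤ y′
                          → suc a * (x + y) ≤ suc b * (x′ + y′)
[a+1]*[x+y]≤[b+1]*[x′+y′] a b x y x′ y′ ax≤ [a+1]y≤ x≤y′ = begin
  suc a * (x + y)              ≡⟨ expand a x y ⟩
  (a * x + suc a * y) + x      ≤⟨ +-mono-≤ (+-mono-≤ ax≤ [a+1]y≤) x≤y′ ⟩
  (suc b * x′ + b * y′) + y′   ≡⟨ collect b x′ y′ ⟩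
  suc b * (x′ + y′)            ∎
  where
    open ≤-Reasoning
    expand : ∀ a x y → suc a * (x + y) ≡ (a * x + suc a * y) + x
    expand = solve-∀
    collect : ∀ b x y → (suc b * x + b * y) + y ≡ suc b * (x + y)
    collect = solve-∀

upSet-level-growth : ∀ {n} {P : Subset n → Bool} → IsUpSet P → ∀ i a → i + a ≡ n
                   → a * level P i ≤ suc i * level P (suc i)
upSet-level-growth             up i       zero     _    = z≤n
upSet-level-growth {suc n} {P} up zero    .(suc n) refl = begin
  suc n * level P 0               ≡⟨ cong (suc n *_) (trans (level-zero P) (sym (+-identityʳ _))) ⟩
  suc n * (level P₀ 0 + 0)        ≤⟨ [a+1]*[x+y]≤[b+1]*[x′+y′] n 0 (level P₀ 0) 0 (level P₀ 1) (level P₁ 0)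
                                       (upSet-level-growth (upSet-outside up) 0 n refl)
                                       (≤-reflexive (*-zeroʳ (suc n)))
                                       (level-mono (upSet-outside⇒inside up) 0) ⟩
  1 * (level P₀ 1 + level P₁ 0)   ≡⟨ cong (1 *_) (level-suc P 0) ⟨
  1 * level P 1                   ∎
  where
    open ≤-Reasoning
    P₀ = P ∘ (outside ∷_)
    P₁ = P ∘ (inside ∷_)
upSet-level-growth {suc _} {P} up (suc j) (suc a)  refl = begin
  suc a * level P (suc j)
    ≡⟨ cong (suc a *_) (level-suc P j) ⟩
  suc a * (level P₀ (suc j) + level P₁ j)
    ≤⟨ [a+1]*[x+y]≤[b+1]*[x′+y′] a (suc j) (level P₀ (suc j)) (level P₁ j)
         (level P₀ (suc (suc j))) (level P₁ (suc j))
         (upSet-level-growth (upSet-outside up) (suc j) a (sym (+-suc j a)))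
         (upSet-level-growth (upSet-inside up) j (suc a) refl)
         (level-mono (upSet-outside⇒inside up) (suc j)) ⟩
  suc (suc j) * (level P₀ (suc (suc j)) + level P₁ (suc j))
    ≡⟨ cong (suc (suc j) *_) (level-suc P (suc j)) ⟨
  suc (suc j) * level P (suc (suc j)) ∎
  where
    open ≤-Reasoning
    P₀ = P ∘ (outside ∷_)
    P₁ = P ∘ (inside ∷_)

upSet-level≤level-suc : ∀ {n} {P : Subset n → Bool} → IsUpSet P → ∀ {i} → suc i + i ≤ n
                      → level P i ≤ level P (suc i)
upSet-level≤level-suc {n} {P} up {i} 2i+1≤n = *-cancelˡ-≤ (suc i) (begin
  suc i * level P i         ≤⟨ *-monoˡ-≤ (level P i) (m+n≤o⇒m≤o∸n (suc i) 2i+1≤n) ⟩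
  (n ∸ i) * level P i       ≤⟨ upSet-level-growth up i (n ∸ i) (m+[n∸m]≡n i≤n) ⟩
  suc i * level P (suc i)   ∎)
  where
    open ≤-Reasoning
    i≤n : i ≤ n
    i≤n = ≤-trans (m≤n+m i (suc i)) 2i+1≤n

∈⇒T-lookup : ∀ {n} {U : Subset n} {v} → v ∈ U → T (lookup U v)
∈⇒T-lookup = from T-≡ ∘ []=⇒lookup

T-lookup⇒∈ : ∀ {n} (U : Subset n) v → T (lookup U v) → v ∈ U
T-lookup⇒∈ U v = lookup⇒[]= v U ∘ to T-≡

T-lookup-mono : ∀ {n} {U V : Subset n} → U ⊆ V → ∀ {v} → T (lookup U v) → T (lookup V v)
T-lookup-mono {U = U} U⊆V {v} = ∈⇒T-lookup ∘ U⊆V ∘ T-lookup⇒∈ U v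

module _ {n} (G : Graph n) where

  Dominated : Subset n → Fin n → Bool
  Dominated U w = lookup U w ∨ any (λ u → lookup U u ∧ adj G u w) (allFin n)

  isDominating-upSet : IsUpSet (isDominating G)
  isDominating-upSet {U} {V} U⊆V =
    all⁻ (Dominated V) {xs = allFin n} ∘ All.map dominated ∘ all⁺ (Dominated U) (allFin n)
    where
      dominated : ∀ {w} → T (Dominated U w) → T (Dominated V w)
      dominated = from T-∨
        ∘ Sum.map (T-lookup-mono U⊆V)
                  (any⁺ _ ∘ Any.map (from T-∧ ∘ map₁ (T-lookup-mono U⊆V) ∘ to T-∧) ∘ any⁻ _ (allFin n))
        ∘ to T-∨

  isDominating-universal : ∀ {U v} → Universal G v → v ∈ U → T (isDominating G U)
  isDominating-universal {U} {v} universal v∈U =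
    all⁻ (Dominated U) {xs = allFin n} (All.tabulate (λ {w} _ → dominated w))
    where
      dominated : ∀ w → T (Dominated U w)
      dominated w with w ≟ᶠ v
      ... | yes refl = from T-∨ (inj₁ (∈⇒T-lookup v∈U))
      ... | no  w≢v  = from T-∨ (inj₂ (any⁺ _ (Any.map edge (∈-allFin v))))
        where
          edge : ∀ {u} → v ≡ u → T (lookup U u ∧ adj G u w)
          edge refl = from T-∧ (∈⇒T-lookup v∈U , from T-≡ (universal w w≢v))

  ¬isDominating⇒⊆∁ : ∀ {S} U → (∀ v → v ∈ S → Universal G v) → ¬ T (isDominating G U) → U ⊆ ∁ S
  ¬isDominating⇒⊆∁ {S} U universal ¬dom {v} v∈U with v ∈? S
  ... | yes v∈S = ⊥-elim (¬dom (isDominating-universal (universal v v∈S) v∈U))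
  ... | no  v∉S = x∉p⇒x∈∁p v∉S

  nCi≤d+∣∁S∣Ci : ∀ {S} → (∀ v → v ∈ S → Universal G v) → ∀ i → n C i ≤ d G i + ∣ ∁ S ∣ C i
  nCi≤d+∣∁S∣Ci {S} universal i = begin
    n C i                                          ≡⟨ cong (_C i) (∣⊤∣≡n n) ⟨
    ∣ ⊤ {n} ∣ C i                                  ≡⟨ level-⊆ (⊤ {n}) i ⟨
    level {n} (_⊆ᵇ ⊤) i                            ≤⟨ level-cover dominating⊎⊆∁ i ⟩
    level (isDominating G) i + level (_⊆ᵇ ∁ S) i   ≡⟨ cong (d G i +_) (level-⊆ (∁ S) i) ⟩
    d G i + ∣ ∁ S ∣ C i                            ∎
    where
      open ≤-Reasoning
      dominating⊎⊆∁ : ∀ U → T (U ⊆ᵇ ⊤) → T (isDominating G U) ⊎ T (U ⊆ᵇ ∁ S)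
      dominating⊎⊆∁ U _ with T? (isDominating G U)
      ... | yes dom = inj₁ dom
      ... | no ¬dom = inj₂ (⊆⇒T-⊆ᵇ U (∁ S) (¬isDominating⇒⊆∁ U universal ¬dom))

  d[i+1]≤d[i] : ∀ {S} → (∀ v → v ∈ S → Universal G v) → n ≤ 2 ^ (∣ S ∣ + 1)
              → ∀ {i} → n + 2 ≤ 2 * i → d G (suc i) ≤ d G i
  d[i+1]≤d[i] {S} universal n≤2^[s+1] {i} n+2≤2i = +-cancelʳ-≤ (∣ ∁ S ∣ C i) _ _ (begin
    d G (suc i) + ∣ ∁ S ∣ C i   ≤⟨ +-monoˡ-≤ (∣ ∁ S ∣ C i) (level≤nCi (isDominating G) (suc i)) ⟩
    n C suc i + ∣ ∁ S ∣ C i     ≤⟨ nC[k+1]+mCk≤nCk ∣ ∁ S ∣ ∣ S ∣ i ∣∁S∣+∣S∣≡n n≤2^[s+1] n+2≤2i ⟩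
    n C i                       ≤⟨ nCi≤d+∣∁S∣Ci universal i ⟩
    d G i + ∣ ∁ S ∣ C i         ∎)
    where
      open ≤-Reasoning
      ∣∁S∣+∣S∣≡n : ∣ ∁ S ∣ + ∣ S ∣ ≡ n
      ∣∁S∣+∣S∣≡n = trans (cong (_+ ∣ S ∣) (∣∁p∣≡n∸∣p∣ S)) (m∸n+n≡m (∣p∣≤n S))

module _ {a : ℕ → ℕ} where

  ascending : ∀ {k} → (∀ i → i < k → a i ≤ a (suc i)) → ∀ i j → i ≤ j → j ≤ k → a i ≤ a j
  ascending up i zero    z≤n   _     = ≤-refl
  ascending up i (suc j) i≤1+j 1+j≤k with m≤n⇒m<n∨m≡n i≤1+j
  ... | inj₂ refl      = ≤-refl
  ... | inj₁ (s≤s i≤j) = ≤-trans (ascending up i j i≤j (<⇒≤ 1+j≤k)) (up j 1+j≤k)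

  descending : ∀ {k n} → (∀ i → k ≤ i → suc i ≤ n → a (suc i) ≤ a i)
             → ∀ i j → k ≤ i → i ≤ j → j ≤ n → a j ≤ a i
  descending down i zero    _   z≤n   _     = ≤-refl
  descending down i (suc j) k≤i i≤1+j 1+j≤n with m≤n⇒m<n∨m≡n i≤1+j
  ... | inj₂ refl      = ≤-refl
  ... | inj₁ (s≤s i≤j) =
    ≤-trans (down j (≤-trans k≤i i≤j) 1+j≤n) (descending down i j k≤i i≤j (<⇒≤ 1+j≤n))

  unimodal-modeAt : ∀ {k n} → k ≤ n → (∀ i → i < k → a i ≤ a (suc i))
                  → (∀ i → k ≤ i → suc i ≤ n → a (suc i) ≤ a i) → (∀ i → n < i → a i ≡ 0)
                  → Unimodal n a × ModeAt a k
  unimodal-modeAt {k} {n} k≤n up down vanish = (k , k≤n , ascending up , descending down) , mode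
    where
      mode : ModeAt a k
      mode i with i ≤? k | i ≤? n
      ... | yes i≤k | _       = ascending up i k i≤k ≤-refl
      ... | no  i≰k | yes i≤n = descending down k i ≤-refl (<⇒≤ (≰⇒> i≰k)) i≤n
      ... | no  _   | no  i≰n = ≤-trans (≤-reflexive (vanish i (≰⇒> i≰n))) z≤n

  unimodal-modeAt-or-suc : ∀ {c n} → c ≤ n → (∀ i → i < c → a i ≤ a (suc i))
                         → (∀ i → suc c ≤ i → suc i ≤ n → a (suc i) ≤ a i) → (∀ i → n < i → a i ≡ 0)
                         → Unimodal n a × (ModeAt a c ⊎ ModeAt a (suc c))
  unimodal-modeAt-or-suc {c} {n} c≤n up down vanish with a (suc c) ≤? a c
  ... | yes fall = map₂ inj₁ (unimodal-modeAt c≤n up down′ vanish)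
    where
      down′ : ∀ i → c ≤ i → suc i ≤ n → a (suc i) ≤ a i
      down′ i c≤i 1+i≤n with m≤n⇒m<n∨m≡n c≤i
      ... | inj₂ refl = fall
      ... | inj₁ c<i  = down i c<i 1+i≤n
  ... | no ¬fall = map₂ inj₂ (unimodal-modeAt 1+c≤n up′ down vanish)
    where
      rise : a c < a (suc c)
      rise = ≰⇒> ¬fall
      up′ : ∀ i → i < suc c → a i ≤ a (suc i)
      up′ i (s≤s i≤c) with m≤n⇒m<n∨m≡n i≤c
      ... | inj₂ refl = <⇒≤ rise
      ... | inj₁ i<c  = up i i<c
      1+c≤n : suc c ≤ n
      1+c≤n with suc c ≤? n
      ... | yes 1+c≤n = 1+c≤n
      ... | no  1+c≰n = ⊥-elim (n≮0 (subst (a c <_) (vanish (suc c) (≰⇒> 1+c≰n)) rise))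

2*⌊n/2⌋≤n : ∀ n → 2 * ⌊ n /2⌋ ≤ n
2*⌊n/2⌋≤n n = begin
  2 * ⌊ n /2⌋          ≡⟨ cong (⌊ n /2⌋ +_) (+-identityʳ ⌊ n /2⌋) ⟩
  ⌊ n /2⌋ + ⌊ n /2⌋    ≤⟨ +-monoʳ-≤ ⌊ n /2⌋ (⌊n/2⌋≤⌈n/2⌉ n) ⟩
  ⌊ n /2⌋ + ⌈ n /2⌉    ≡⟨ ⌊n/2⌋+⌈n/2⌉≡n n ⟩
  n                    ∎
  where open ≤-Reasoning

n≤2*⌈n/2⌉ : ∀ n → n ≤ 2 * ⌈ n /2⌉
n≤2*⌈n/2⌉ n = begin
  n                    ≡⟨ ⌊n/2⌋+⌈n/2⌉≡n n ⟨
  ⌊ n /2⌋ + ⌈ n /2⌉    ≤⟨ +-monoˡ-≤ ⌈ n /2⌉ (⌊n/2⌋≤⌈n/2⌉ n) ⟩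
  ⌈ n /2⌉ + ⌈ n /2⌉    ≡⟨ cong (⌈ n /2⌉ +_) (+-identityʳ ⌈ n /2⌉) ⟨
  2 * ⌈ n /2⌉          ∎
  where open ≤-Reasoning

i<⌈n/2⌉⇒1+2i≤n : ∀ {n i} → i < ⌈ n /2⌉ → suc i + i ≤ n
i<⌈n/2⌉⇒1+2i≤n {n} {i} i<⌈n/2⌉ = ≤-pred (begin
  suc (suc i + i)      ≡⟨ +-suc (suc i) i ⟨
  suc i + suc i        ≡⟨ cong (suc i +_) (+-identityʳ (suc i)) ⟨
  2 * suc i            ≤⟨ *-monoʳ-≤ 2 i<⌈n/2⌉ ⟩
  2 * ⌈ n /2⌉          ≤⟨ 2*⌊n/2⌋≤n (suc n) ⟩
  suc n                ∎)
  where open ≤-Reasoning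

⌈n/2⌉<i⇒n+2≤2i : ∀ {n i} → ⌈ n /2⌉ < i → n + 2 ≤ 2 * i
⌈n/2⌉<i⇒n+2≤2i {n} {i} ⌈n/2⌉<i = begin
  n + 2                ≤⟨ +-monoˡ-≤ 2 (n≤2*⌈n/2⌉ n) ⟩
  2 * ⌈ n /2⌉ + 2      ≡⟨ +-comm (2 * ⌈ n /2⌉) 2 ⟩
  2 + 2 * ⌈ n /2⌉      ≡⟨ *-suc 2 ⌈ n /2⌉ ⟨
  2 * suc ⌈ n /2⌉      ≤⟨ *-monoʳ-≤ 2 ⌈n/2⌉<i ⟩
  2 * i                ∎
  where open ≤-Reasoning

theorem7p4 : (n : ℕ) → 1 ≤ n → (G : Graph n) → (S : Subset n)
    → (∀ v → v ∈ S → Universal G v) → n ≤ 2 ^ (∣ S ∣ + 1)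
    → Unimodal n (d G) × (ModeAt (d G) ⌈ n /2⌉ ⊎ ModeAt (d G) (⌈ n /2⌉ + 1))
theorem7p4 n _ G S universal n≤2^[s+1] rewrite +-comm ⌈ n /2⌉ 1 =
  unimodal-modeAt-or-suc (⌈n/2⌉≤n n)
    (λ i i<⌈n/2⌉ → upSet-level≤level-suc (isDominating-upSet G) (i<⌈n/2⌉⇒1+2i≤n i<⌈n/2⌉))
    (λ i ⌈n/2⌉<i _ → d[i+1]≤d[i] G universal n≤2^[s+1] (⌈n/2⌉<i⇒n+2≤2i ⌈n/2⌉<i))
    (λ i → level-vanish (isDominating G))
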